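{- For every focused natural deduction proof with unification of a MILL1 sequent $\Gamma \vdash_p B$ (or $\Gamma\vdash_n B$), there is an ordinary MILL1 natural deduction proof of $\Gamma \vdash B$.
   Context: MILL1 (no function symbols, no equality): terms are variables or constants; atomic formulas $a(t_1,\ldots,t_m)$; formulas $F ::= \mathcal{A} \mid F\multimap F \mid \forall x.F$, up to renaming of bound variables. Ordinary natural deduction: hypothesis $A\vdash A$; $\multimap E$ (from $\Gamma\vdash A\multimap B$, $\Delta\vdash A$ infer $\Gamma,\Delta\vdash B$); $\multimap I$ (from $\Gamma,A\vdash B$ infer $\Gamma\vdash A\multimap B$); $\forall E$ (from $\Gamma\vdash\forall x.A$ infer $\Gamma\vdash A[x:=t]$); $\forall I$ (from $\Gamma\vdash A[y:=x]$ infer $\Gamma\vdash \forall x.A$, $y$ not free in $\Gamma$, $x$ not in $A$). Focused natural deduction with unification uses meta-variables and two kinds of sequents $\Gamma\vdash_n C$ and $\Gamma\vdash_p C$. Unification of formulas: atoms unify argumentwise (same predicate and arity required), $A_1\multimap B_1$ with $A_2\multimap B_2$ componentwise, $\forall x.A$ with $\forall y.B$ as $A$ with $B[y:=x]$, bound variables treated as constants and no capture allowed. Rules: lexicon $A\vdash_n A$ ($A$ closed); hypothesis $A\vdash_n A$; focus shift from $\Gamma\vdash_n A$ to $\Gamma\vdash_p A$; $\multimap E$: from $\Gamma\vdash_n B\multimap A$ and $\Delta\vdash_p B'$ infer $s(\Gamma),s(\Delta)\vdash_n s(A)$ with $s$ the most general unifier of $\langle\Gamma,B\rangle$ and $\langle\Delta,B'\rangle$;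 $\multimap I$: from $\Gamma,B\vdash_p A$ infer $\Gamma\vdash_p B\multimap A$; $\forall E$: from $\Gamma\vdash_n\forall x.A$ infer $\Gamma\vdash_n A[x:=D]$, $D$ a fresh meta-variable; $\forall I$: from $\Gamma\vdash_p A[y:=x]$ infer $\Gamma\vdash_p\forall x.A$, $y$ a variable or meta-variable not free in undischarged hypotheses. In the claim, $\Gamma$ and $B$ are taken after applying the most general unifier computed for the whole proof (remaining meta-variables may be read as free variables). -}

module Defs where

open import Data.Nat using (ℕ; zero; suc; _≡ᵇ_)
open import Data.Bool using (if_then_else_)
open import Data.Sum using (_⊎_; inj₁; inj₂)
open import Data.Product using (Σ; _×_; _,_)
open import Data.List using (List; []; _∷_; _++_; map; concatMap)
open import Data.List.Membership.Propositional using (_∉_)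
open import Relation.Binary.PropositionalEquality using (_≡_)

-- Syntax of MILL1 (locally nameless: bound variables are de Bruijn
-- indices, so formulas are automatically taken up to renaming of bound
-- variables).

-- Free "variables": inj₁ n is the ordinary (object) variable number n,
-- inj₂ m is the meta-variable number m.
Var : Set
Var = ℕ ⊎ ℕ

data LTerm : Set where
  var : Var → LTerm
  con : ℕ → LTerm

data Term : Set where
  bvar : ℕ → Term
  lt   : LTerm → Term

-- Formulas: atoms a(t₁,…,tₘ) (predicate symbol and argument list; the
-- arity is the length of the list), linear implication, universal
-- quantification.
infixr 5 _⊸_
data Formula : Set where
  atom : ℕ → List Term → Formula
  _⊸_  : Formula → Formula → Formula
  ∀'   : Formula → Formula

openT : ℕ → LTerm → Term → Term
openT k u (bvar i) = if i ≡ᵇ k then lt u else bvar i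
openT k u (lt t)   = lt t

openF : ℕ → LTerm → Formula → Formula
openF k u (atom a ts) = atom a (map (openT k u) ts)
openF k u (A ⊸ B)     = openF k u A ⊸ openF k u B
openF k u (∀' A)      = ∀' (openF (suc k) u A)

-- A[x:=t] for A the body of ∀x.A
inst : Formula → LTerm → Formula
inst A u = openF 0 u A

fvL : LTerm → List Var
fvL (var y) = y ∷ []
fvL (con c) = []

fvT : Term → List Var
fvT (bvar i) = []
fvT (lt t)   = fvL t

fvF : Formula → List Var
fvF (atom a ts) = concatMap fvT ts
fvF (A ⊸ B)     = fvF A ++ fvF B
fvF (∀' A)      = fvF A

fvCtx : List Formula → List Var
fvCtx = concatMap fvF

Closed : Formula → Set
Closed A = fvF A ≡ []

-- Substitutions of meta-variables (by locally closed terms, so no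
-- capture of bound variables is possible).

Subst : Set
Subst = ℕ → LTerm

subL : Subst → LTerm → LTerm
subL s (var (inj₁ x)) = var (inj₁ x)
subL s (var (inj₂ m)) = s m
subL s (con c)        = con c

subT : Subst → Term → Term
subT s (bvar i) = bvar i
subT s (lt t)   = lt (subL s t)

subF : Subst → Formula → Formula
subF s (atom a ts) = atom a (map (subT s) ts)
subF s (A ⊸ B)     = subF s A ⊸ subF s B
subF s (∀' A)      = ∀' (subF s A)

-- s unifies A and B (structural equality after substitution: atoms
-- argumentwise with same predicate and arity, implications componentwise,
-- quantifier bodies with bound variables treated as constants).
Unifier : Subst → Formula → Formula → Set
Unifier s A B = subF s A ≡ subF s B

IsMGU : Subst → Formula → Formula → Set
IsMGU s A B =
  Unifier s A B ×
  ((t : Subst) → Unifier t A B →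
     Σ Subst (λ r → (m : ℕ) → subL r (s m) ≡ t m))

-- Ordinary MILL1 natural deduction (contexts are lists used as
-- multisets: the discharged hypothesis may occur at any position).
-- Meta-variables (inj₂ m) are here just further free variables.

infix 3 _⊢_
data _⊢_ : List Formula → Formula → Set where
  hyp  : ∀ {A} → (A ∷ []) ⊢ A
  ⊸E   : ∀ {Γ Δ A B} → Γ ⊢ A ⊸ B → Δ ⊢ A → (Γ ++ Δ) ⊢ B
  ⊸I   : ∀ {Γ₁ Γ₂ A B} → (Γ₁ ++ A ∷ Γ₂) ⊢ B → (Γ₁ ++ Γ₂) ⊢ A ⊸ B
  ∀E   : ∀ {Γ A} → Γ ⊢ ∀' A → (t : LTerm) → Γ ⊢ inst A t
  ∀I   : ∀ {Γ A} (y : Var) → y ∉ fvCtx Γ → y ∉ fvF A →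
         Γ ⊢ inst A (var y) → Γ ⊢ ∀' A

infix 3 _⊢ₙ_ _⊢ₚ_
data _⊢ₙ_ : List Formula → Formula → Set
data _⊢ₚ_ : List Formula → Formula → Set

data _⊢ₙ_ where
  lex   : ∀ {A} → Closed A → (A ∷ []) ⊢ₙ A
  hyp   : ∀ {A} → (A ∷ []) ⊢ₙ A
  ⊸E    : ∀ {Γ Δ A B B'} → Γ ⊢ₙ B ⊸ A → Δ ⊢ₚ B' →
          (s : Subst) → IsMGU s B B' →
          (map (subF s) Γ ++ map (subF s) Δ) ⊢ₙ subF s A
  ∀E    : ∀ {Γ A} → Γ ⊢ₙ ∀' A → (D : ℕ) →
          inj₂ D ∉ fvCtx Γ → inj₂ D ∉ fvF A →
          Γ ⊢ₙ inst A (var (inj₂ D))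

data _⊢ₚ_ where
  shift : ∀ {Γ A} → Γ ⊢ₙ A → Γ ⊢ₚ A
  ⊸I    : ∀ {Γ₁ Γ₂ A B} → (Γ₁ ++ B ∷ Γ₂) ⊢ₚ A → (Γ₁ ++ Γ₂) ⊢ₚ B ⊸ A
  ∀I    : ∀ {Γ A} (y : Var) → y ∉ fvCtx Γ → y ∉ fvF A →
          Γ ⊢ₚ inst A (var y) → Γ ⊢ₚ ∀' A

module Submission where

-- A focused derivation may instantiate meta-variables by most general
-- unifiers at every ⊸E step, so a sub-derivation concluding Γ ⊢ A only
-- appears in the final proof in the instantiated form s(Γ) ⊢ s(A).  We
-- therefore prove a stronger statement by mutual induction on focused
-- derivations: for every valuation σ, a total substitution of locally
-- closed terms for all free variables and meta-variables, σ(Γ) ⊢ σ(B)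
-- is derivable in ordinary natural deduction.  The proposition is the
-- instance σ = identity.
--
-- In the ∀I case the eigenvariable y is
-- renamed, via an updated valuation, to an object variable fresh for
-- σ(Γ) and σ(A); in the ⊸E case the valuation is composed with the
-- unifier.

open import Defs
open import Data.Product using (_×_; _,_; proj₁; proj₂)
open import Data.List using (List; []; _∷_; _++_; map; concatMap)
open import Data.List.Properties using (map-++; map-∘; map-cong; map-id)
open import Data.List.Membership.Propositional using (_∈_; _∉_)
open import Data.List.Membership.Propositional.Properties using (∈-++⁺ˡ; ∈-++⁺ʳ)
open import Data.List.Relation.Unary.Any using (here; there)
open import Data.Nat using (ℕ; suc; _≡ᵇ_; _⊔_; _<_; _≟_)
open import Data.Nat.Properties using (≤-trans; m≤m⊔n; m≤n⊔m; <-irrefl)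
open import Data.Bool using (true; false)
open import Data.Sum using (inj₁; inj₂)
open import Data.Sum.Properties using (≡-dec)
open import Data.Empty using (⊥-elim)
open import Relation.Nullary using (Dec; yes; no)
open import Relation.Binary.PropositionalEquality
  using (_≡_; refl; sym; trans; cong; cong₂; subst; subst₂; module ≡-Reasoning)

Valuation : Set
Valuation = Var → LTerm

appL : Valuation → LTerm → LTerm
appL σ (var y) = σ y
appL σ (con c) = con c

appT : Valuation → Term → Term
appT σ (bvar i) = bvar i
appT σ (lt t)   = lt (appL σ t)

appF : Valuation → Formula → Formula
appF σ (atom a ts) = atom a (map (appT σ) ts)
appF σ (A ⊸ B)     = appF σ A ⊸ appF σ B
appF σ (∀' A)      = ∀' (appF σ A)

appCtx : Valuation → List Formula → List Formula
appCtx σ = map (appF σ)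

map-fuse : {X Y Z : Set} {f : Y → Z} {g : X → Y} {h : X → Z} →
           (∀ x → f (g x) ≡ h x) → (xs : List X) → map f (map g xs) ≡ map h xs
map-fuse fg≗h xs = trans (sym (map-∘ xs)) (map-cong fg≗h xs)

_⊙_ : Valuation → Subst → Valuation
(σ ⊙ s) (inj₁ x) = σ (inj₁ x)
(σ ⊙ s) (inj₂ m) = appL σ (s m)

⊙-L : ∀ σ s u → appL σ (subL s u) ≡ appL (σ ⊙ s) u
⊙-L σ s (var (inj₁ x)) = refl
⊙-L σ s (var (inj₂ m)) = refl
⊙-L σ s (con c)        = refl

⊙-T : ∀ σ s u → appT σ (subT s u) ≡ appT (σ ⊙ s) u
⊙-T σ s (bvar i) = refl
⊙-T σ s (lt u)   = cong lt (⊙-L σ s u)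

⊙-F : ∀ σ s A → appF σ (subF s A) ≡ appF (σ ⊙ s) A
⊙-F σ s (atom a ts) = cong (atom a) (map-fuse (⊙-T σ s) ts)
⊙-F σ s (A ⊸ B)     = cong₂ _⊸_ (⊙-F σ s A) (⊙-F σ s B)
⊙-F σ s (∀' A)      = cong ∀' (⊙-F σ s A)

id-L : ∀ u → appL var u ≡ u
id-L (var y) = refl
id-L (con c) = refl

id-T : ∀ u → appT var u ≡ u
id-T (bvar i) = refl
id-T (lt u)   = cong lt (id-L u)

id-F : ∀ A → appF var A ≡ A
id-F (atom a ts) = cong (atom a) (trans (map-cong id-T ts) (map-id ts))
id-F (A ⊸ B)     = cong₂ _⊸_ (id-F A) (id-F B)
id-F (∀' A)      = cong ∀' (id-F A)

id-Ctx : ∀ Γ → appCtx var Γ ≡ Γ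
id-Ctx Γ = trans (map-cong id-F Γ) (map-id Γ)

open-T : ∀ σ k u w → appT σ (openT k u w) ≡ openT k (appL σ u) (appT σ w)
open-T σ k u (bvar i) with i ≡ᵇ k
... | true  = refl
... | false = refl
open-T σ k u (lt t) = refl

open-F : ∀ σ k u A → appF σ (openF k u A) ≡ openF k (appL σ u) (appF σ A)
open-F σ k u (atom a ts) =
  cong (atom a) (trans (map-fuse (open-T σ k u) ts) (map-∘ ts))
open-F σ k u (A ⊸ B) = cong₂ _⊸_ (open-F σ k u A) (open-F σ k u B)
open-F σ k u (∀' A)  = cong ∀' (open-F σ (suc k) u A)

Agree : Valuation → Valuation → List Var → Set
Agree σ τ xs = ∀ v → v ∈ xs → σ v ≡ τ v

agree-map : {X Y : Set} (fv : X → List Var) (act : Valuation → X → Y) →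
            (∀ σ τ x → Agree σ τ (fv x) → act σ x ≡ act τ x) →
            ∀ σ τ xs → Agree σ τ (concatMap fv xs) → map (act σ) xs ≡ map (act τ) xs
agree-map fv act agree σ τ []       ag = refl
agree-map fv act agree σ τ (x ∷ xs) ag =
  cong₂ _∷_ (agree σ τ x (λ v p → ag v (∈-++⁺ˡ p)))
            (agree-map fv act agree σ τ xs (λ v p → ag v (∈-++⁺ʳ (fv x) p)))

agree-L : ∀ σ τ u → Agree σ τ (fvL u) → appL σ u ≡ appL τ u
agree-L σ τ (var y) ag = ag y (here refl)
agree-L σ τ (con c) ag = refl

agree-T : ∀ σ τ u → Agree σ τ (fvT u) → appT σ u ≡ appT τ u
agree-T σ τ (bvar i) ag = refl
agree-T σ τ (lt u)   ag = cong lt (agree-L σ τ u ag)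

agree-F : ∀ σ τ A → Agree σ τ (fvF A) → appF σ A ≡ appF τ A
agree-F σ τ (atom a ts) ag = cong (atom a) (agree-map fvT appT agree-T σ τ ts ag)
agree-F σ τ (A ⊸ B) ag =
  cong₂ _⊸_ (agree-F σ τ A (λ v p → ag v (∈-++⁺ˡ p)))
            (agree-F σ τ B (λ v p → ag v (∈-++⁺ʳ (fvF A) p)))
agree-F σ τ (∀' A) ag = cong ∀' (agree-F σ τ A ag)

agree-Ctx : ∀ σ τ Γ → Agree σ τ (fvCtx Γ) → appCtx σ Γ ≡ appCtx τ Γ
agree-Ctx = agree-map fvF appF agree-F

_≟V_ : (x y : Var) → Dec (x ≡ y)
_≟V_ = ≡-dec _≟_ _≟_

_[_↦_] : Valuation → Var → LTerm → Valuation
(σ [ y ↦ u ]) v with v ≟V y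
... | yes _ = u
... | no  _ = σ v

update-hit : ∀ σ y u → (σ [ y ↦ u ]) y ≡ u
update-hit σ y u with y ≟V y
... | yes _   = refl
... | no  y≢y = ⊥-elim (y≢y refl)

update-miss : ∀ σ y u xs → y ∉ xs → Agree (σ [ y ↦ u ]) σ xs
update-miss σ y u xs y∉xs v v∈xs with v ≟V y
... | yes refl = ⊥-elim (y∉xs v∈xs)
... | no  _    = refl

update-open : ∀ σ y u A → y ∉ fvF A →
              appF (σ [ y ↦ u ]) (inst A (var y)) ≡ inst (appF σ A) u
update-open σ y u A y∉A = begin
  appF σ' (inst A (var y))        ≡⟨ open-F σ' 0 (var y) A ⟩
  inst (appF σ' A) (σ' y)         ≡⟨ cong₂ (λ B t → inst B t)
                                       (agree-F σ' σ A (update-miss σ y u _ y∉A))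
                                       (update-hit σ y u) ⟩
  inst (appF σ A) u               ∎
  where
    open ≡-Reasoning
    σ' = σ [ y ↦ u ]

bound : List Var → ℕ
bound []             = 0
bound (inj₁ n ∷ xs) = suc n ⊔ bound xs
bound (inj₂ _ ∷ xs) = bound xs

bound-above : ∀ xs n → inj₁ n ∈ xs → n < bound xs
bound-above (inj₁ m ∷ xs) n (here refl) = m≤m⊔n (suc m) (bound xs)
bound-above (inj₁ m ∷ xs) n (there p)   =
  ≤-trans (bound-above xs n p) (m≤n⊔m (suc m) (bound xs))
bound-above (inj₂ _ ∷ xs) n (there p)   = bound-above xs n p

fresh : List Var → Var
fresh xs = inj₁ (bound xs)

fresh-∉ : ∀ xs → fresh xs ∉ xs
fresh-∉ xs p = <-irrefl refl (bound-above xs (bound xs) p)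

fresh-++ : ∀ xs ys → fresh (xs ++ ys) ∉ xs × fresh (xs ++ ys) ∉ ys
fresh-++ xs ys = (λ p → fresh-∉ (xs ++ ys) (∈-++⁺ˡ p))
               , (λ p → fresh-∉ (xs ++ ys) (∈-++⁺ʳ xs p))

unifier-⊙ : ∀ σ s B B' → Unifier s B B' → appF (σ ⊙ s) B' ≡ appF (σ ⊙ s) B
unifier-⊙ σ s B B' s-unifies = begin
  appF (σ ⊙ s) B'     ≡⟨ sym (⊙-F σ s B') ⟩
  appF σ (subF s B')  ≡⟨ cong (appF σ) (sym s-unifies) ⟩
  appF σ (subF s B)   ≡⟨ ⊙-F σ s B ⟩
  appF (σ ⊙ s) B      ∎
  where open ≡-Reasoning

⊙-Ctx-++ : ∀ σ s Γ Δ → appCtx σ (map (subF s) Γ ++ map (subF s) Δ)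
                       ≡ appCtx (σ ⊙ s) Γ ++ appCtx (σ ⊙ s) Δ
⊙-Ctx-++ σ s Γ Δ = trans (map-++ (appF σ) (map (subF s) Γ) (map (subF s) Δ))
                         (cong₂ _++_ (map-fuse (⊙-F σ s) Γ) (map-fuse (⊙-F σ s) Δ))

instanceₚ : ∀ {Γ B} → Γ ⊢ₚ B → (σ : Valuation) → appCtx σ Γ ⊢ appF σ B
instanceₙ : ∀ {Γ B} → Γ ⊢ₙ B → (σ : Valuation) → appCtx σ Γ ⊢ appF σ B

instanceₚ (shift d) σ = instanceₙ d σ
instanceₚ (⊸I {Γ₁} {Γ₂} {B = B} d) σ =
  subst (_⊢ _) (sym (map-++ (appF σ) Γ₁ Γ₂))
    (⊸I (subst (_⊢ _) (map-++ (appF σ) Γ₁ (B ∷ Γ₂)) (instanceₚ d σ)))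
instanceₚ (∀I {Γ} {A} y y∉Γ y∉A d) σ = ∀I z z∉Γ z∉A renamed
  where
    -- rename the eigenvariable y to an object variable z fresh for σ(Γ), σ(A)
    z = fresh (fvCtx (appCtx σ Γ) ++ fvF (appF σ A))
    z∉Γ = proj₁ (fresh-++ (fvCtx (appCtx σ Γ)) (fvF (appF σ A)))
    z∉A = proj₂ (fresh-++ (fvCtx (appCtx σ Γ)) (fvF (appF σ A)))
    renamed : appCtx σ Γ ⊢ inst (appF σ A) (var z)
    renamed = subst₂ _⊢_
      (agree-Ctx (σ [ y ↦ var z ]) σ Γ (update-miss σ y (var z) _ y∉Γ))
      (update-open σ y (var z) A y∉A)
      (instanceₚ d (σ [ y ↦ var z ]))

instanceₙ (lex _) σ = hyp
instanceₙ hyp     σ = hyp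
instanceₙ (⊸E {Γ} {Δ} {A} {B} {B'} d e s (s-unifies , _)) σ =
  subst₂ _⊢_ (sym (⊙-Ctx-++ σ s Γ Δ)) (sym (⊙-F σ s A))
    (⊸E (instanceₙ d (σ ⊙ s))
        (subst (_ ⊢_) (unifier-⊙ σ s B B' s-unifies) (instanceₚ e (σ ⊙ s))))
instanceₙ (∀E {A = A} d D _ _) σ =
  subst (_ ⊢_) (sym (open-F σ 0 (var (inj₂ D)) A)) (∀E (instanceₙ d σ) (σ (inj₂ D)))

proposition3 : ((Γ : List Formula) (B : Formula) → Γ ⊢ₚ B → Γ ⊢ B)
    × ((Γ : List Formula) (B : Formula) → Γ ⊢ₙ B → Γ ⊢ B)
proposition3 = (λ Γ B d → subst₂ _⊢_ (id-Ctx Γ) (id-F B) (instanceₚ d var))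
             , (λ Γ B d → subst₂ _⊢_ (id-Ctx Γ) (id-F B) (instanceₙ d var))
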